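{- Let $b$ be a positive integer and $t$ an integer with $0\le t\le b$ and $2t>b$. Let $M=(m_n)_{n\ge0}$ be the lexicographically smallest nonperiodic sequence in $\Gamma(\{b-t,\ldots,t\})$ (equivalently, the smallest element of $\Gamma_{strict}(\{b-t,\ldots,t\})$; this smallest element exists). Then $$\forall n\ge0,\quad m_n=\varepsilon_{n+1}-(2t-b-1)\varepsilon_n+t-1,$$ where $(\varepsilon_n)_{n\ge0}$ is the Thue–Morse sequence. Consequently: (i) if $2t\ge b+3$, then $M$ is the fixed point beginning with $t$ of the morphism obtained from $\Theta$ by renaming $e_0,e_1,e_2,e_3$ as $b-t,\ b-t+1,\ t-1,\ t$ respectively (these four integers are then distinct), i.e. the morphism $t\mapsto t\,(b-t+1)$, $(t-1)\mapsto t\,(b-t)$, $(b-t+1)\mapsto (b-t)\,t$, $(b-t)\mapsto (b-t)\,(t-1)$; (ii) if $2t=b+2$, then $M$ is the letterwise image of the fixed point $\Theta^\infty(e_3)$ under the map $g$ with $g(e_3)=t$, $g(e_2)=g(e_1)=t-1$, $g(e_0)=b-t$; (iii) if $2t=b+1$, then $M$ is the letterwise image of $\Theta^\infty(e_3)$ under the map $h$ with $h(e_3)=h(e_1)=t$, $h(e_2)=h(e_0)=t-1$.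
   Context: $\{b-t,\ldots,t\}$ carries the natural order of the integers and the bar operation $\overline{x}=b-x$, extended letterwise to sequences. $\sigma$ is the shift $\sigma((a_n)_{n\ge0})=(a_{n+1})_{n\ge0}$ and $\le$ the lexicographical order on sequences ($A<B$ means $A\le B$, $A\neq B$). $\Gamma(\mathcal A)$ is the set of $A=(a_n)\in\mathcal A^{\mathbb N}$ with $a_0=\max\mathcal A$ and $\overline{A}\le\sigma^kA\le A$ for all $k\ge0$; $\Gamma_{strict}(\mathcal A)$ is the set of $A\in\mathcal A^{\mathbb N}$ with $a_0=\max\mathcal A$ and $\overline{A}<\sigma^kA<A$ for all $k\ge1$. A sequence is periodic if $\sigma^kA=A$ for some $k\ge1$. The Thue–Morse sequence is defined by $\varepsilon_0=0$, $\varepsilon_{2k}=\varepsilon_k$, $\varepsilon_{2k+1}=1-\varepsilon_k$. The morphism $\Theta$ on the alphabet $\{e_0,e_1,e_2,e_3\}$ is $\Theta(e_3)=e_3e_1$, $\Theta(e_2)=e_3e_0$, $\Theta(e_1)=e_0e_3$, $\Theta(e_0)=e_0e_2$, and $\Theta^\infty(e_3)=\lim_{k\to\infty}\Theta^k(e_3)$ is its infinite fixed point beginning with $e_3$. -}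

module Defs where

open import Data.Nat as ℕ using (ℕ; zero; suc; _+_; _*_; _∸_)
open import Data.Integer as ℤ using (ℤ; +_; _-_)
open import Data.Integer.Base using () renaming (_*_ to _*ℤ_; _<_ to _<ℤ_; _≤_ to _≤ℤ_)
open import Data.List using (List; []; _∷_; _++_)
open import Data.Product using (Σ; ∃; _×_; _,_)
open import Relation.Binary.PropositionalEquality using (_≡_)
open import Relation.Nullary using (¬_)

Seq : Set
Seq = ℕ → ℤ

shift : ℕ → Seq → Seq
shift k A n = A (k + n)

_<lex_ : Seq → Seq → Set
A <lex B = ∃ λ n → (∀ i → i ℕ.< n → A i ≡ B i) × (A n <ℤ B n)

-- A ≤ B lexicographically.  The lexicographic order is total, so
-- A ≤ B  iff  not (B < A); this is the constructively usable form.
_≤lex_ : Seq → Seq → Set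
A ≤lex B = ¬ (B <lex A)

InAlphabet : ℕ → ℕ → ℤ → Set
InAlphabet b t x = ((+ b) - (+ t) ≤ℤ x) × (x ≤ℤ + t)

bar : ℕ → Seq → Seq
bar b A n = (+ b) - A n

Γ : ℕ → ℕ → Seq → Set
Γ b t A = (∀ n → InAlphabet b t (A n))
        × (A 0 ≡ + t)
        × (∀ k → (bar b A ≤lex shift k A) × (shift k A ≤lex A))

Γstrict : ℕ → ℕ → Seq → Set
Γstrict b t A = (∀ n → InAlphabet b t (A n))
              × (A 0 ≡ + t)
              × (∀ k → 1 ℕ.≤ k → (bar b A <lex shift k A) × (shift k A <lex A))

Periodic : Seq → Set
Periodic A = ∃ λ k → (1 ℕ.≤ k) × (∀ n → A (k + n) ≡ A n)

NonperiodicΓ : ℕ → ℕ → Seq → Set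
NonperiodicΓ b t A = Γ b t A × ¬ Periodic A

IsLeast : (Seq → Set) → Seq → Set
IsLeast S A = S A × (∀ B → S B → A ≤lex B)

IsThueMorse : (ℕ → ℕ) → Set
IsThueMorse ε = (ε 0 ≡ 0)
              × (∀ k → ε (2 * k) ≡ ε k)
              × (∀ k → ε (suc (2 * k)) ≡ 1 ∸ ε k)

Mseq : ℕ → ℕ → (ℕ → ℕ) → Seq
Mseq b t ε n = (+ ε (suc n)) - (((+ (2 * t)) - (+ b) - (+ 1)) *ℤ (+ ε n)) ℤ.+ (+ t) - (+ 1)

data E : Set where
  e₀ e₁ e₂ e₃ : E

Θ : E → List E
Θ e₃ = e₃ ∷ e₁ ∷ []
Θ e₂ = e₃ ∷ e₀ ∷ []
Θ e₁ = e₀ ∷ e₃ ∷ []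
Θ e₀ = e₀ ∷ e₂ ∷ []

Θword : List E → List E
Θword [] = []
Θword (x ∷ w) = Θ x ++ Θword w

Θiter : ℕ → List E
Θiter zero = e₃ ∷ []
Θiter (suc k) = Θword (Θiter k)

nthOr : E → List E → ℕ → E
nthOr d [] _ = d
nthOr d (x ∷ w) zero = x
nthOr d (x ∷ w) (suc n) = nthOr d w n

-- n-th letter of Θ^∞(e₃): Θ^{n+1}(e₃) has length 2^{n+1} > n and is a
-- prefix of Θ^∞(e₃), so the default letter is never used.
Θ∞ : ℕ → E
Θ∞ n = nthOr e₃ (Θiter (suc n)) n

gmap : ℕ → ℕ → E → ℤ
gmap b t e₃ = + t
gmap b t e₂ = (+ t) - (+ 1)
gmap b t e₁ = (+ t) - (+ 1)
gmap b t e₀ = (+ b) - (+ t)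

hmap : ℕ → ℕ → E → ℤ
hmap b t e₃ = + t
hmap b t e₁ = + t
hmap b t e₂ = (+ t) - (+ 1)
hmap b t e₀ = (+ t) - (+ 1)

-- The renamed morphism of (i), as its list of rules  x ↦ y z :
--   t ↦ t (b-t+1),  (t-1) ↦ t (b-t),  (b-t+1) ↦ (b-t) t,  (b-t) ↦ (b-t) (t-1)
data RenamedRule (b t : ℕ) : ℤ → ℤ → ℤ → Set where
  rule₃ : RenamedRule b t (+ t) (+ t) ((+ b) - (+ t) ℤ.+ (+ 1))
  rule₂ : RenamedRule b t ((+ t) - (+ 1)) (+ t) ((+ b) - (+ t))
  rule₁ : RenamedRule b t ((+ b) - (+ t) ℤ.+ (+ 1)) ((+ b) - (+ t)) (+ t)
  rule₀ : RenamedRule b t ((+ b) - (+ t)) ((+ b) - (+ t)) ((+ t) - (+ 1))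

IsRenamedFixedPoint : ℕ → ℕ → Seq → Set
IsRenamedFixedPoint b t A =
  (A 0 ≡ + t) × (∀ n → RenamedRule b t (A n) (A (2 * n)) (A (suc (2 * n))))

{-# OPTIONS --safe #-}

-- Write t = d + e + 1 and b = t + d, so that e = 2t - b - 1. Then m_n only depends on the
-- pair (ε_n, ε_{n+1}), and the letters are ordered so that comparing shifts of M reduces to
-- locating where a shift of the Thue–Morse sequence first departs from (the complement of)
-- its own shift; the recursions ε_{2k} = ε_k, ε_{2k+1} = 1 - ε_k control these departures,
-- which puts M in Γ_strict. For minimality, let B ∈ Γ be smaller than M, first differing
-- at 2^k + j with j < 2^k. Since the second block of length 2^k of M is the bar of the
-- first, the inequality σ^{2^k} B ≥ B̄ forces j = 2^k - 1 and B = w w̄ … with |w| = 2^k,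
-- and then the inequalities of Γ propagate w w̄ w w̄ …, so B is periodic.
-- Finally Θ^∞(e₃) is the Thue–Morse sequence read through the pairs (ε_n, ε_{n+1}).

module Submission where

open import Defs
open import Data.Nat using (ℕ; _+_; _*_; _≤_; _<_)
open import Data.Integer using (+_; _-_) renaming (_+_ to _+ℤ_; _<_ to _<ℤ_)
open import Data.Product using (_×_)
open import Relation.Binary.PropositionalEquality using (_≡_)

open import Data.Bool using (Bool; true; false; not; _xor_)
open import Data.Bool.Properties using (not-involutive; not-distribʳ-xor; xor-identityʳ)
open import Data.Empty using (⊥-elim)
open import Data.Integer using (ℤ; _⊖_; +<+; +≤+) renaming (_≤_ to _≤ℤ_; _*_ to _*ℤ_)
import Data.Integer.Properties as ℤ
import Data.Integer.Tactic.RingSolver as ℤ-Solver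
open import Data.List using ([]; _∷_; _++_; length)
open import Data.Nat using (zero; suc; _∸_; _^_; _≡ᵇ_; z≤n; s≤s; NonZero; >-nonZero)
open import Data.Nat.DivMod using (_%_; _/_; m%n<n; m≡m%n+[m/n]*n)
open import Data.Nat.Induction using (<-rec)
import Data.Nat.Properties as ℕ
import Data.Nat.Tactic.RingSolver as ℕ-Solver
open import Data.Product using (∃; ∃₂; _,_; proj₁; proj₂)
open import Data.Sum using (_⊎_; inj₁; inj₂)
open import Function using (_∘_)
open import Relation.Binary.PropositionalEquality
  using (_≢_; refl; sym; trans; cong; cong₂; subst; subst₂; _≗_; module ≡-Reasoning)
open import Relation.Binary.Definitions using (tri<; tri≈; tri>)
open import Relation.Nullary using (¬_)

open ≡-Reasoning

≡0⊎≥1 : ∀ n → n ≡ 0 ⊎ 1 ≤ n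
≡0⊎≥1 zero    = inj₁ refl
≡0⊎≥1 (suc n) = inj₂ (s≤s z≤n)

data EvenOdd : ℕ → Set where
  even : ∀ k → EvenOdd (2 * k)
  odd  : ∀ k → EvenOdd (suc (2 * k))

evenOdd : ∀ n → EvenOdd n
evenOdd zero = even 0
evenOdd (suc n) with evenOdd n
... | even k = odd k
... | odd k = subst EvenOdd (ℕ.*-suc 2 k) (even (suc k))

half-< : ∀ {j m} → 2 * j < 2 * m → j < m
half-< = ℕ.*-cancelˡ-< 2 _ _

half-<-odd : ∀ {j m} → suc (2 * j) < 2 * m → j < m
half-<-odd lt = half-< (ℕ.<-trans (ℕ.n<1+n _) lt)

split-< : ∀ h {i j} → j < h + i → j < h ⊎ ∃ λ j′ → j ≡ h + j′ × j′ < i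
split-< zero j<i = inj₂ (_ , refl , j<i)
split-< (suc h) {j = zero} _ = inj₁ (s≤s z≤n)
split-< (suc h) {j = suc j} (s≤s j<) with split-< h j<
... | inj₁ j<h = inj₁ (s≤s j<h)
... | inj₂ (j′ , refl , j′<i) = inj₂ (j′ , refl , j′<i)

double : ∀ n → n + n ≡ 2 * n
double n = cong (λ m → n + m) (sym (ℕ.+-identityʳ n))

2^n<2^[1+n] : ∀ n → 2 ^ n < 2 ^ suc n
2^n<2^[1+n] n = ℕ.^-monoʳ-< 2 (s≤s (s≤s z≤n)) (ℕ.n<1+n n)

n<2^n : ∀ n → n < 2 ^ n
n<2^n zero = s≤s z≤n
n<2^n (suc n) = ℕ.≤-<-trans (n<2^n n) (2^n<2^[1+n] n)

leading-power : ∀ n → 1 ≤ n → ∃₂ λ k j → n ≡ 2 ^ k + j × j < 2 ^ k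
leading-power (suc zero) _ = 0 , 0 , refl , s≤s z≤n
leading-power (suc (suc n)) _ with leading-power (suc n) (s≤s z≤n)
... | k , j , n≡ , j<h with ℕ.m≤n⇒m<n∨m≡n j<h
...   | inj₁ sj<h = k , suc j , trans (cong suc n≡) (sym (ℕ.+-suc _ j)) , sj<h
...   | inj₂ sj≡h = suc k , 0 , n≡2h , ℕ.m^n>0 2 (suc k)
  where
  n≡2h : suc (suc n) ≡ 2 ^ suc k + 0
  n≡2h = begin
    suc (suc n)     ≡⟨ cong suc n≡ ⟩
    suc (2 ^ k + j) ≡⟨ ℕ.+-suc (2 ^ k) j ⟨
    2 ^ k + suc j   ≡⟨ cong (λ m → 2 ^ k + m) sj≡h ⟩
    2 ^ k + 2 ^ k   ≡⟨ double (2 ^ k) ⟩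
    2 ^ suc k       ≡⟨ ℕ.+-identityʳ _ ⟨
    2 ^ suc k + 0   ∎

≗⇒¬<lex : ∀ {A B} → A ≗ B → ¬ (A <lex B)
≗⇒¬<lex A≗B (n , _ , A<B) = ℤ.<-irrefl (A≗B n) A<B

<⇒≤lex : ∀ {A B} → A <lex B → A ≤lex B
<⇒≤lex (n , agree , A<B) (n′ , agree′ , B<A) with ℕ.<-cmp n n′
... | tri< n<n′ _ _ = ℤ.<-irrefl (sym (agree′ n n<n′)) A<B
... | tri≈ _ refl _ = ℤ.<-asym A<B B<A
... | tri> _ _ n′<n = ℤ.<-irrefl (sym (agree n′ n′<n)) B<A

<lex-resp-≗ : ∀ {A A′ B B′} → A ≗ A′ → B ≗ B′ → A′ <lex B′ → A <lex B
<lex-resp-≗ A≗A′ B≗B′ (n , agree , A′<B′) =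
  n , (λ i i<n → trans (A≗A′ i) (trans (agree i i<n) (sym (B≗B′ i))))
    , subst₂ _<ℤ_ (sym (A≗A′ n)) (sym (B≗B′ n)) A′<B′

agree-below : ∀ (A B : Seq) n →
  (∀ i → i < n → (∀ j → j < i → A j ≡ B j) → ¬ (A i <ℤ B i) × ¬ (B i <ℤ A i)) →
  ∀ i → i < n → A i ≡ B i
agree-below A B n incomparable = <-rec (λ i → i < n → A i ≡ B i) step
  where
  step : ∀ i → (∀ {j} → j < i → j < n → A j ≡ B j) → i < n → A i ≡ B i
  step i rec i<n with incomparable i i<n (λ j j<i → rec j<i (ℕ.<-trans j<i i<n))
  ... | A≮B , B≮A = ℤ.≤-antisym (ℤ.≮⇒≥ B≮A) (ℤ.≮⇒≥ A≮B)

≤lex-antisym : ∀ {A B} → A ≤lex B → B ≤lex A → A ≗ B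
≤lex-antisym {A} {B} A≤B B≤A n = agree-below A B (suc n) incomparable n ℕ.≤-refl
  where
  incomparable : ∀ i → i < suc n → (∀ j → j < i → A j ≡ B j) →
                 ¬ (A i <ℤ B i) × ¬ (B i <ℤ A i)
  incomparable i _ agree = (λ A<B → B≤A (i , agree , A<B))
                         , (λ B<A → A≤B (i , (λ j j<i → sym (agree j j<i)) , B<A))

IsLeast-unique : ∀ {S A B} → IsLeast S A → IsLeast S B → A ≗ B
IsLeast-unique (A∈S , A-least) (B∈S , B-least) = ≤lex-antisym (A-least _ B∈S) (B-least _ A∈S)

x<1+n∧x≮n⇒x≡n : ∀ {x} n → x <ℤ + suc n → ¬ (x <ℤ + n) → x ≡ + n
x<1+n∧x≮n⇒x≡n n x<n+1 x≮n = ℤ.≤-antisym (ℤ.i<j⇒i≤pred[j] x<n+1) (ℤ.≮⇒≥ x≮n)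

-- Sequences of Γ with an antiperiodic prefix are periodic

ShiftOrdered : ℕ → Seq → Set
ShiftOrdered b B = ∀ k → (bar b B ≤lex shift k B) × (shift k B ≤lex B)

bar-bar : ∀ (m x : ℤ) → m - (m - x) ≡ x
bar-bar = ℤ-Solver.solve-∀

-- If B = w w̄ … with |w| = h and B[p, p + 2h) = w w̄, then σ^{p+2h} B ≤ B and
-- σ^{p+h} B ≥ B̄ = w̄ w … pin the next block to w, and dually the one after it to w̄.
module AntiperiodicPrefix {b h : ℕ} {B : Seq} (ordered : ShiftOrdered b B)
  (anti : ∀ i → i < h → B (h + i) ≡ bar b B i) where

  B≡bar-anti : ∀ i → i < h → B i ≡ bar b B (h + i)
  B≡bar-anti i i<h = sym (trans (cong (λ x → + b - x) (anti i i<h)) (bar-bar (+ b) (B i)))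

  Repeats : ℕ → Set
  Repeats p = ∀ i → i < h → B (p + i) ≡ B i × B (p + h + i) ≡ bar b B i

  repeats-step : ∀ p → Repeats p → Repeats (p + (h + h))
  repeats-step p rep i i<h = first i i<h , second i i<h
    where
    reassoc : ∀ p h i → p + (h + h) + i ≡ p + h + (h + i)
    reassoc = ℕ-Solver.solve-∀

    first : ∀ i → i < h → B (p + (h + h) + i) ≡ B i
    first = agree-below (shift (p + (h + h)) B) B h λ i i<h agree →
        (λ lt → proj₁ (ordered (p + h))
                  (h + i , bar-prefix i i<h agree ,
                   subst₂ _<ℤ_ (cong B (reassoc p h i)) (B≡bar-anti i i<h) lt))
      , (λ gt → proj₂ (ordered (p + (h + h))) (i , (λ j j<i → sym (agree j j<i)) , gt))
      where
      bar-prefix : ∀ i → i < h → (∀ j → j < i → B (p + (h + h) + j) ≡ B j) →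
                   ∀ j → j < h + i → B (p + h + j) ≡ bar b B j
      bar-prefix i i<h agree j j< with split-< h j<
      ... | inj₁ j<h = proj₂ (rep j j<h)
      ... | inj₂ (j′ , refl , j′<i) = begin
        B (p + h + (h + j′))   ≡⟨ cong B (reassoc p h j′) ⟨
        B (p + (h + h) + j′)   ≡⟨ agree j′ j′<i ⟩
        B j′                   ≡⟨ B≡bar-anti j′ (ℕ.<-trans j′<i i<h) ⟩
        bar b B (h + j′)       ∎

    second : ∀ i → i < h → B (p + (h + h) + h + i) ≡ bar b B i
    second = agree-below (shift (p + (h + h) + h) B) (bar b B) h λ i i<h agree →
        (λ lt → proj₁ (ordered (p + (h + h) + h)) (i , agree , lt))
      , (λ gt → proj₂ (ordered (p + (h + h)))
                  (h + i , first-prefix i i<h agree ,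
                   subst₂ _<ℤ_ (sym (anti i i<h)) (cong B (ℕ.+-assoc (p + (h + h)) h i)) gt))
      where
      first-prefix : ∀ i → i < h → (∀ j → j < i → B (p + (h + h) + h + j) ≡ bar b B j) →
                     ∀ j → j < h + i → B j ≡ B (p + (h + h) + j)
      first-prefix i i<h agree j j< with split-< h j<
      ... | inj₁ j<h = sym (first j j<h)
      ... | inj₂ (j′ , refl , j′<i) = begin
        B (h + j′)                   ≡⟨ anti j′ (ℕ.<-trans j′<i i<h) ⟩
        bar b B j′                   ≡⟨ agree j′ j′<i ⟨
        B (p + (h + h) + h + j′)     ≡⟨ cong B (ℕ.+-assoc (p + (h + h)) h j′) ⟩
        B (p + (h + h) + (h + j′))   ∎

  repeats : ∀ q → Repeats (q * (h + h))
  repeats zero i i<h = refl , anti i i<h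
  repeats (suc q) = subst Repeats (ℕ.+-comm (q * (h + h)) (h + h)) (repeats-step _ (repeats q))

  repeats⇒prefix : ∀ p → Repeats p → ∀ r → r < h + h → B (p + r) ≡ B r
  repeats⇒prefix p rep r r< with split-< h r<
  ... | inj₁ r<h = proj₁ (rep r r<h)
  ... | inj₂ (r′ , refl , r′<h) = begin
    B (p + (h + r′))   ≡⟨ cong B (ℕ.+-assoc p h r′) ⟨
    B (p + h + r′)     ≡⟨ proj₂ (rep r′ r′<h) ⟩
    bar b B r′         ≡⟨ anti r′ r′<h ⟨
    B (h + r′)         ∎

  periodic : 1 ≤ h → Periodic B
  periodic h≥1 = h + h , period≥1 , λ n → begin
      B (h + h + n)                       ≡⟨ cong (λ m → B (h + h + m)) (m≡m%n+[m/n]*n n (h + h)) ⟩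
      B (h + h + (r n + q n * (h + h)))   ≡⟨ cong B (regroup (h + h) (r n) (q n)) ⟩
      B (suc (q n) * (h + h) + r n)       ≡⟨ repeats⇒prefix _ (repeats (suc (q n))) (r n) (r<2h n) ⟩
      B (r n)                             ≡⟨ repeats⇒prefix _ (repeats (q n)) (r n) (r<2h n) ⟨
      B (q n * (h + h) + r n)             ≡⟨ cong B (ℕ.+-comm (q n * (h + h)) (r n)) ⟩
      B (r n + q n * (h + h))             ≡⟨ cong B (m≡m%n+[m/n]*n n (h + h)) ⟨
      B n                                 ∎
    where
    period≥1 : 1 ≤ h + h
    period≥1 = ℕ.≤-trans h≥1 (ℕ.m≤m+n h h)
    instance
      period≢0 : NonZero (h + h)
      period≢0 = >-nonZero period≥1
    r q : ℕ → ℕ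
    r n = n % (h + h)
    q n = n / (h + h)
    r<2h : ∀ n → r n < h + h
    r<2h n = m%n<n n (h + h)
    regroup : ∀ L r q → L + (r + q * L) ≡ suc q * L + r
    regroup = ℕ-Solver.solve-∀

antiperiodic-prefix⇒periodic : ∀ {b h B} → ShiftOrdered b B → 1 ≤ h →
  (∀ i → i < h → B (h + i) ≡ bar b B i) → Periodic B
antiperiodic-prefix⇒periodic ordered h≥1 anti = AntiperiodicPrefix.periodic ordered anti h≥1

-- The morphism Θ on pairs of consecutive letters

-- code x y is the letter of Θ^∞(e₃) at a position n with (ε_n, ε_{n+1}) = (x, y).
code : Bool → Bool → E
code false false = e₂
code false true  = e₃
code true  false = e₀
code true  true  = e₁

Θ-code : ∀ x y → Θ (code x y) ≡ code x (not x) ∷ code (not x) y ∷ []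
Θ-code false false = refl
Θ-code false true  = refl
Θ-code true  false = refl
Θ-code true  true  = refl

length-Θ++ : ∀ x w → length (Θ x ++ w) ≡ suc (suc (length w))
length-Θ++ e₀ w = refl
length-Θ++ e₁ w = refl
length-Θ++ e₂ w = refl
length-Θ++ e₃ w = refl

nthOr-Θ++ : ∀ x w n → nthOr e₃ (Θ x ++ w) (suc (suc n)) ≡ nthOr e₃ w n
nthOr-Θ++ e₀ w n = refl
nthOr-Θ++ e₁ w n = refl
nthOr-Θ++ e₂ w n = refl
nthOr-Θ++ e₃ w n = refl

length-Θword : ∀ w → length (Θword w) ≡ 2 * length w
length-Θword [] = refl
length-Θword (x ∷ w) = begin
  length (Θ x ++ Θword w)        ≡⟨ length-Θ++ x (Θword w) ⟩
  suc (suc (length (Θword w)))   ≡⟨ cong (suc ∘ suc) (length-Θword w) ⟩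
  suc (suc (2 * length w))       ≡⟨ ℕ.*-suc 2 (length w) ⟨
  2 * suc (length w)             ∎

length-Θiter : ∀ k → length (Θiter k) ≡ 2 ^ k
length-Θiter zero = refl
length-Θiter (suc k) = trans (length-Θword (Θiter k)) (cong (2 *_) (length-Θiter k))

nthOr-Θword : ∀ w i {x y} → i < length w → nthOr e₃ w i ≡ code x y →
    nthOr e₃ (Θword w) (2 * i) ≡ code x (not x)
  × nthOr e₃ (Θword w) (suc (2 * i)) ≡ code (not x) y
nthOr-Θword (_ ∷ w) zero {x} {y} _ refl rewrite Θ-code x y = refl , refl
nthOr-Θword (c ∷ w) (suc i) (s≤s i<) wᵢ rewrite ℕ.*-suc 2 i
                                             | nthOr-Θ++ c (Θword w) (2 * i)
                                             | nthOr-Θ++ c (Θword w) (suc (2 * i)) =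
  nthOr-Θword w i i< wᵢ

≡⊎≡not : ∀ x y → x ≡ y ⊎ x ≡ not y
≡⊎≡not false false = inj₁ refl
≡⊎≡not false true  = inj₂ refl
≡⊎≡not true  false = inj₂ refl
≡⊎≡not true  true  = inj₁ refl

xor-true : ∀ c → c xor true ≡ not c
xor-true false = refl
xor-true true  = refl

module ThueMorse (τ : ℕ → Bool)
  (τ-zero : τ 0 ≡ false)
  (τ-even : ∀ k → τ (2 * k) ≡ τ k)
  (τ-odd  : ∀ k → τ (suc (2 * k)) ≡ not (τ k)) where

  τ-one : τ 1 ≡ true
  τ-one = trans (τ-odd 0) (cong not τ-zero)

  τ-two : τ 2 ≡ true
  τ-two = trans (τ-even 1) τ-one

  τ-even-suc : ∀ k → τ (suc (suc (2 * k))) ≡ τ (suc k)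
  τ-even-suc k = trans (cong τ (sym (ℕ.*-suc 2 k))) (τ-even (suc k))

  -- m is the first position where σ^s τ differs from σ τ, complemented if c is true;
  -- only for s = 1 and c = false is there no such position.
  Departure : Bool → ℕ → Set
  Departure c s = ∃ λ m → (∀ i → i < m → τ (s + i) ≡ c xor τ (suc i))
                        × τ (s + m) ≡ c × τ (suc m) ≡ true

  departure-even-same : ∀ c a → τ a ≡ c → Departure c (2 * a)
  departure-even-same c a τa≡c =
    0 , (λ _ ()) , trans (cong τ (ℕ.+-identityʳ _)) (trans (τ-even a) τa≡c) , τ-one

  departure-even-flip : ∀ c a → τ a ≡ not c → Departure c (2 * a)
  departure-even-flip c a τa≡¬c = 1 , agree , last , τ-two
    where
    agree : ∀ i → i < 1 → τ (2 * a + i) ≡ c xor τ (suc i)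
    agree zero _ = begin
      τ (2 * a + 0) ≡⟨ cong τ (ℕ.+-identityʳ _) ⟩
      τ (2 * a)     ≡⟨ trans (τ-even a) τa≡¬c ⟩
      not c         ≡⟨ xor-true c ⟨
      c xor true    ≡⟨ cong (c xor_) τ-one ⟨
      c xor τ 1     ∎
    agree (suc i) (s≤s ())
    last : τ (2 * a + 1) ≡ c
    last = begin
      τ (2 * a + 1)     ≡⟨ cong τ (ℕ.+-comm (2 * a) 1) ⟩
      τ (suc (2 * a))   ≡⟨ τ-odd a ⟩
      not (τ a)         ≡⟨ cong not τa≡¬c ⟩
      not (not c)       ≡⟨ not-involutive c ⟩
      c                 ∎

  departure-odd-flip : ∀ c a → τ a ≡ not c → Departure c (suc (2 * a))
  departure-odd-flip c a τa≡¬c = 0 , (λ _ ()) , last , τ-one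
    where
    last : τ (suc (2 * a) + 0) ≡ c
    last = begin
      τ (suc (2 * a) + 0) ≡⟨ cong τ (ℕ.+-identityʳ _) ⟩
      τ (suc (2 * a))     ≡⟨ τ-odd a ⟩
      not (τ a)           ≡⟨ cong not τa≡¬c ⟩
      not (not c)         ≡⟨ not-involutive c ⟩
      c                   ∎

  departure-odd-step : ∀ c a → τ a ≡ c → Departure c (suc a) → Departure c (suc (2 * a))
  departure-odd-step c a τa≡c (m , agree , last , last′) =
    suc (2 * m) , agree′ , trans (cong τ (odd+odd a m)) (trans (τ-even _) last)
                , trans (τ-even-suc m) last′
    where
    odd+even : ∀ a j → suc (2 * a) + 2 * j ≡ suc (2 * (a + j))
    odd+even = ℕ-Solver.solve-∀
    odd+odd : ∀ a j → suc (2 * a) + suc (2 * j) ≡ 2 * (suc a + j)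
    odd+odd = ℕ-Solver.solve-∀

    shifted : ∀ j → j ≤ m → τ (a + j) ≡ c xor τ j
    shifted zero _ = begin
      τ (a + 0)     ≡⟨ cong τ (ℕ.+-identityʳ a) ⟩
      τ a           ≡⟨ τa≡c ⟩
      c             ≡⟨ xor-identityʳ c ⟨
      c xor false   ≡⟨ cong (c xor_) τ-zero ⟨
      c xor τ 0     ∎
    shifted (suc j) j<m = trans (cong τ (ℕ.+-suc a j)) (agree j j<m)

    agree′ : ∀ i → i < suc (2 * m) → τ (suc (2 * a) + i) ≡ c xor τ (suc i)
    agree′ i i< with evenOdd i
    ... | even j = begin
      τ (suc (2 * a) + 2 * j)   ≡⟨ cong τ (odd+even a j) ⟩
      τ (suc (2 * (a + j)))     ≡⟨ τ-odd (a + j) ⟩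
      not (τ (a + j))           ≡⟨ cong not (shifted j (ℕ.*-cancelˡ-≤ 2 (ℕ.≤-pred i<))) ⟩
      not (c xor τ j)           ≡⟨ not-distribʳ-xor c (τ j) ⟩
      c xor not (τ j)           ≡⟨ cong (c xor_) (τ-odd j) ⟨
      c xor τ (suc (2 * j))     ∎
    ... | odd j = begin
      τ (suc (2 * a) + suc (2 * j)) ≡⟨ cong τ (odd+odd a j) ⟩
      τ (2 * (suc a + j))           ≡⟨ τ-even _ ⟩
      τ (suc a + j)                 ≡⟨ agree j (half-< (ℕ.≤-pred i<)) ⟩
      c xor τ (suc j)               ≡⟨ cong (c xor_) (τ-even-suc j) ⟨
      c xor τ (suc (suc (2 * j)))   ∎

  departure : ∀ c s → (s ≡ 1 → c ≡ true) → Departure c s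
  departure c = <-rec (λ s → (s ≡ 1 → c ≡ true) → Departure c s) step
    where
    step : ∀ s → (∀ {r} → r < s → (r ≡ 1 → c ≡ true) → Departure c r)
         → (s ≡ 1 → c ≡ true) → Departure c s
    step s rec nondegenerate with evenOdd s
    ... | even a with ≡⊎≡not (τ a) c
    ...   | inj₁ same = departure-even-same c a same
    ...   | inj₂ flip = departure-even-flip c a flip
    step s rec nondegenerate | odd a with ≡⊎≡not (τ a) c
    ...   | inj₂ flip = departure-odd-flip c a flip
    step s rec nondegenerate | odd zero | inj₁ same =
      ⊥-elim (false≢true (trans (sym τ-zero) (trans same (nondegenerate refl))))
      where false≢true : false ≢ true
            false≢true ()
    step s rec nondegenerate | odd (suc a) | inj₁ same =
      departure-odd-step c (suc a) same (rec (s≤s (s≤s (ℕ.m<m+n a (s≤s z≤n)))) (λ ()))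

  τ-block : ∀ k i → i < 2 ^ k → τ (2 ^ k + i) ≡ not (τ i)
  τ-block zero zero _ = τ-odd 0
  τ-block zero (suc i) (s≤s ())
  τ-block (suc k) i i< with evenOdd i
  ... | even j = begin
    τ (2 * 2 ^ k + 2 * j)   ≡⟨ cong τ (ℕ.*-distribˡ-+ 2 (2 ^ k) j) ⟨
    τ (2 * (2 ^ k + j))     ≡⟨ τ-even _ ⟩
    τ (2 ^ k + j)           ≡⟨ τ-block k j (half-< i<) ⟩
    not (τ j)               ≡⟨ cong not (τ-even j) ⟨
    not (τ (2 * j))         ∎
  ... | odd j = begin
    τ (2 * 2 ^ k + suc (2 * j))   ≡⟨ cong τ (even+odd (2 ^ k) j) ⟩
    τ (suc (2 * (2 ^ k + j)))     ≡⟨ τ-odd _ ⟩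
    not (τ (2 ^ k + j))           ≡⟨ cong not (τ-block k j (half-<-odd i<)) ⟩
    not (not (τ j))               ≡⟨ cong not (τ-odd j) ⟨
    not (τ (suc (2 * j)))         ∎
    where
    even+odd : ∀ p j → 2 * p + suc (2 * j) ≡ suc (2 * (p + j))
    even+odd = ℕ-Solver.solve-∀

  τ-power : ∀ k → τ (2 ^ k) ≡ true
  τ-power k = begin
    τ (2 ^ k)       ≡⟨ cong τ (ℕ.+-identityʳ _) ⟨
    τ (2 ^ k + 0)   ≡⟨ τ-block k 0 (ℕ.m^n>0 2 k) ⟩
    not (τ 0)       ≡⟨ cong not τ-zero ⟩
    true            ∎

  Θiter-code : ∀ k n → n < 2 ^ k → nthOr e₃ (Θiter k) n ≡ code (τ n) (τ (suc n))
  Θiter-code zero zero _ = cong₂ code (sym τ-zero) (sym τ-one)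
  Θiter-code zero (suc n) (s≤s ())
  Θiter-code (suc k) n n< with evenOdd n
  ... | even j = trans (proj₁ (nthOr-Θword (Θiter k) j j<length (Θiter-code k j j<2^k)))
                       (cong₂ code (sym (τ-even j)) (sym (τ-odd j)))
    where
    j<2^k : j < 2 ^ k
    j<2^k = half-< n<
    j<length : j < length (Θiter k)
    j<length = subst (j <_) (sym (length-Θiter k)) j<2^k
  ... | odd j = trans (proj₂ (nthOr-Θword (Θiter k) j j<length (Θiter-code k j j<2^k)))
                      (cong₂ code (sym (τ-odd j)) (sym (τ-even-suc j)))
    where
    j<2^k : j < 2 ^ k
    j<2^k = half-<-odd n<
    j<length : j < length (Θiter k)
    j<length = subst (j <_) (sym (length-Θiter k)) j<2^k

  Θ∞-code : ∀ n → Θ∞ n ≡ code (τ n) (τ (suc n))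
  Θ∞-code n = Θiter-code (suc n) n (ℕ.<-trans (n<2^n n) (2^n<2^[1+n] n))

bit : Bool → ℕ
bit false = 0
bit true  = 1

letter : ℤ → ℤ → Bool → Bool → ℤ
letter B T false false = T - + 1
letter B T false true  = T
letter B T true  false = B - T
letter B T true  true  = B - T +ℤ + 1

letter-formula : ∀ x y (B T : ℤ) →
  + bit y - ((T +ℤ T - B - + 1) *ℤ + bit x) +ℤ T - + 1 ≡ letter B T x y
letter-formula false false = solved
  where solved : ∀ B T → + 0 - ((T +ℤ T - B - + 1) *ℤ + 0) +ℤ T - + 1 ≡ T - + 1
        solved = ℤ-Solver.solve-∀
letter-formula false true  = solved
  where solved : ∀ B T → + 1 - ((T +ℤ T - B - + 1) *ℤ + 0) +ℤ T - + 1 ≡ T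
        solved = ℤ-Solver.solve-∀
letter-formula true  false = solved
  where solved : ∀ B T → + 0 - ((T +ℤ T - B - + 1) *ℤ + 1) +ℤ T - + 1 ≡ B - T
        solved = ℤ-Solver.solve-∀
letter-formula true  true  = solved
  where solved : ∀ B T → + 1 - ((T +ℤ T - B - + 1) *ℤ + 1) +ℤ T - + 1 ≡ B - T +ℤ + 1
        solved = ℤ-Solver.solve-∀

letter-bar : ∀ x y (B T : ℤ) → B - letter B T x y ≡ letter B T (not x) (not y)
letter-bar false false = solved
  where solved : ∀ B T → B - (T - + 1) ≡ B - T +ℤ + 1
        solved = ℤ-Solver.solve-∀
letter-bar false true  B T = refl
letter-bar true  false B T = bar-bar B T
letter-bar true  true  = solved
  where solved : ∀ B T → B - (B - T +ℤ + 1) ≡ T - + 1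
        solved = ℤ-Solver.solve-∀

letter-rule : ∀ b t x y →
  RenamedRule b t (letter (+ b) (+ t) x y) (letter (+ b) (+ t) x (not x)) (letter (+ b) (+ t) (not x) y)
letter-rule b t false false = rule₂
letter-rule b t false true  = rule₃
letter-rule b t true  false = rule₀
letter-rule b t true  true  = rule₁

RenamedRule-resp : ∀ {b t x x′ y y′ z z′} → x ≡ x′ → y ≡ y′ → z ≡ z′ →
  RenamedRule b t x′ y′ z′ → RenamedRule b t x y z
RenamedRule-resp refl refl refl r = r

Mseq-letter : ∀ b t ε (τ : ℕ → Bool) → (∀ n → ε n ≡ bit (τ n)) →
  ∀ n → Mseq b t ε n ≡ letter (+ b) (+ t) (τ n) (τ (suc n))
Mseq-letter b t ε τ ε≡τ n = begin
  Mseq b t ε n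
    ≡⟨ cong₂ (formula (+ (2 * t))) (ε≡τ n) (ε≡τ (suc n)) ⟩
  formula (+ (2 * t)) (τ′ n) (τ′ (suc n))
    ≡⟨ cong (λ T2 → formula T2 (τ′ n) (τ′ (suc n))) 2t≡t+t ⟩
  formula (+ t +ℤ + t) (τ′ n) (τ′ (suc n))
    ≡⟨ letter-formula (τ n) (τ (suc n)) (+ b) (+ t) ⟩
  letter (+ b) (+ t) (τ n) (τ (suc n))
    ∎
  where
  τ′ : ℕ → ℕ
  τ′ = bit ∘ τ
  formula : ℤ → ℕ → ℕ → ℤ
  formula T2 x y = + y - ((T2 - + b - + 1) *ℤ + x) +ℤ + t - + 1
  2t≡t+t : + (2 * t) ≡ + t +ℤ + t
  2t≡t+t = trans (cong +_ (sym (double t))) (ℤ.pos-+ t t)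

≤1⇒≡bit : ∀ {x} → x ≤ 1 → x ≡ bit (x ≡ᵇ 1)
≤1⇒≡bit z≤n       = refl
≤1⇒≡bit (s≤s z≤n) = refl

≤1⇒∸≡ᵇ : ∀ {x} → x ≤ 1 → (1 ∸ x ≡ᵇ 1) ≡ not (x ≡ᵇ 1)
≤1⇒∸≡ᵇ z≤n       = refl
≤1⇒∸≡ᵇ (s≤s z≤n) = refl

module Booleanised (ε : ℕ → ℕ) (isTM : IsThueMorse ε) where

  private
    ε-zero : ε 0 ≡ 0
    ε-zero = proj₁ isTM
    ε-even : ∀ k → ε (2 * k) ≡ ε k
    ε-even = proj₁ (proj₂ isTM)
    ε-odd : ∀ k → ε (suc (2 * k)) ≡ 1 ∸ ε k
    ε-odd = proj₂ (proj₂ isTM)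

  ε≤1 : ∀ n → ε n ≤ 1
  ε≤1 = <-rec (λ n → ε n ≤ 1) step
    where
    step : ∀ n → (∀ {m} → m < n → ε m ≤ 1) → ε n ≤ 1
    step n rec with evenOdd n
    ... | even zero = subst (_≤ 1) (sym ε-zero) z≤n
    ... | even (suc k) = subst (_≤ 1) (sym (ε-even (suc k))) (rec (ℕ.m<m+n (suc k) (s≤s z≤n)))
    ... | odd k = subst (_≤ 1) (sym (ε-odd k)) (ℕ.m∸n≤m 1 (ε k))

  τ : ℕ → Bool
  τ n = ε n ≡ᵇ 1

  ε≡bit-τ : ∀ n → ε n ≡ bit (τ n)
  ε≡bit-τ n = ≤1⇒≡bit (ε≤1 n)

  τ-zero : τ 0 ≡ false
  τ-zero = cong (_≡ᵇ 1) ε-zero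

  τ-even : ∀ k → τ (2 * k) ≡ τ k
  τ-even k = cong (_≡ᵇ 1) (ε-even k)

  τ-odd : ∀ k → τ (suc (2 * k)) ≡ not (τ k)
  τ-odd k = trans (cong (_≡ᵇ 1) (ε-odd k)) (≤1⇒∸≡ᵇ (ε≤1 k))

-- The sequence M for t = d + e + 1 and b = t + d

module Smallest (d e : ℕ) (ε : ℕ → ℕ) (isTM : IsThueMorse ε) where

  open Booleanised ε isTM
  open ThueMorse τ τ-zero τ-even τ-odd

  t b : ℕ
  t = suc (d + e)
  b = t + d

  M : Seq
  M = Mseq b t ε

  b-t≡d : + b - + t ≡ + d
  b-t≡d = begin
    + b - + t       ≡⟨ ℤ.[+m]-[+n]≡m⊖n b t ⟩
    b ⊖ t           ≡⟨ ℤ.⊖-≥ (ℕ.m≤m+n t d) ⟩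
    + (t + d ∸ t)   ≡⟨ cong +_ (ℕ.m+n∸m≡n t d) ⟩
    + d             ∎

  level : Bool → Bool → ℕ
  level false false = d + e
  level false true  = t
  level true  false = d
  level true  true  = suc d

  letter≡level : ∀ x y → letter (+ b) (+ t) x y ≡ + level x y
  letter≡level false false = refl
  letter≡level false true  = refl
  letter≡level true  false = b-t≡d
  letter≡level true  true  = trans (cong (_+ℤ + 1) b-t≡d) (cong +_ (ℕ.+-comm d 1))

  level-bar : ∀ x y → + b - + level x y ≡ + level (not x) (not y)
  level-bar x y = begin
    + b - + level x y                    ≡⟨ cong (λ z → + b - z) (letter≡level x y) ⟨
    + b - letter (+ b) (+ t) x y         ≡⟨ letter-bar x y (+ b) (+ t) ⟩
    letter (+ b) (+ t) (not x) (not y)   ≡⟨ letter≡level (not x) (not y) ⟩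
    + level (not x) (not y)              ∎

  level-in-alphabet : ∀ x y → InAlphabet b t (+ level x y)
  level-in-alphabet x y =
    subst (_≤ℤ + level x y) (sym b-t≡d) (+≤+ (d≤level x y)) , +≤+ (level≤t x y)
    where
    d≤level : ∀ x y → d ≤ level x y
    d≤level false false = ℕ.m≤m+n d e
    d≤level false true  = ℕ.≤-trans (ℕ.m≤m+n d e) (ℕ.n≤1+n _)
    d≤level true  false = ℕ.≤-refl
    d≤level true  true  = ℕ.n≤1+n d
    level≤t : ∀ x y → level x y ≤ t
    level≤t false false = ℕ.n≤1+n _
    level≤t false true  = ℕ.≤-refl
    level≤t true  false = ℕ.≤-trans (ℕ.m≤m+n d e) (ℕ.n≤1+n _)
    level≤t true  true  = s≤s (ℕ.m≤m+n d e)

  level-suc : ∀ x → level x true ≡ suc (level x false)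
  level-suc false = refl
  level-suc true  = refl

  d+e≡d : e ≡ 0 → d + e ≡ d
  d+e≡d e≡0 = trans (cong (λ m → d + m) e≡0) (ℕ.+-identityʳ d)

  level-first-irrelevant : e ≡ 0 → ∀ x y → level x y ≡ level true y
  level-first-irrelevant e≡0 false false = d+e≡d e≡0
  level-first-irrelevant e≡0 false true  = cong suc (d+e≡d e≡0)
  level-first-irrelevant e≡0 true  y     = refl

  level-cong : ∀ {x x′} y → x ≡ x′ ⊎ e ≡ 0 → level x y ≡ level x′ y
  level-cong y (inj₁ refl) = refl
  level-cong {x} {x′} y (inj₂ e≡0) =
    trans (level-first-irrelevant e≡0 x y) (sym (level-first-irrelevant e≡0 x′ y))

  level-false<level-true : ∀ {x x′} → x ≡ x′ ⊎ e ≡ 0 → level x false < level x′ true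
  level-false<level-true {x′ = x′} x∼x′ =
    subst₂ _<_ (sym (level-cong false x∼x′)) (sym (level-suc x′)) (ℕ.n<1+n _)

  level-true<level-false : 1 ≤ e → ∀ {y y′} → y ≡ false ⊎ y′ ≡ true →
    level true y < level false y′
  level-true<level-false e≥1 {false} {false} _ = ℕ.m<m+n d e≥1
  level-true<level-false e≥1 {false} {true}  _ = s≤s (ℕ.m≤m+n d e)
  level-true<level-false e≥1 {true}  {true}  _ = s≤s (ℕ.m<m+n d e≥1)
  level-true<level-false e≥1 {true}  {false} (inj₁ ())
  level-true<level-false e≥1 {true}  {false} (inj₂ ())

  levels : (ℕ → Bool) → Seq
  levels p n = + level (p n) (p (suc n))

  M≗letter : ∀ n → M n ≡ letter (+ b) (+ t) (τ n) (τ (suc n))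
  M≗letter = Mseq-letter b t ε τ ε≡bit-τ

  M≗levels : M ≗ levels τ
  M≗levels n = trans (M≗letter n) (letter≡level (τ n) (τ (suc n)))

  shift-M≗levels : ∀ k → shift k M ≗ levels (λ n → τ (k + n))
  shift-M≗levels k n =
    trans (M≗levels (k + n)) (cong (λ m → + level (τ (k + n)) (τ m)) (sym (ℕ.+-suc k n)))

  bar-M≗levels : bar b M ≗ levels (not ∘ τ)
  bar-M≗levels n = trans (cong (λ z → + b - z) (M≗levels n)) (level-bar (τ n) (τ (suc n)))

  levels-<lex-tail : ∀ p q m → p 0 ≡ q 0 ⊎ e ≡ 0 →
    (∀ i → i < m → p (suc i) ≡ q (suc i)) → p (suc m) ≡ false → q (suc m) ≡ true →
    levels p <lex levels q
  levels-<lex-tail p q m head agree p-last q-last = m , agree′ , +<+ last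
    where
    first-agree : ∀ i → i ≤ m → p i ≡ q i ⊎ e ≡ 0
    first-agree zero _ = head
    first-agree (suc i) i<m = inj₁ (agree i i<m)
    agree′ : ∀ i → i < m → levels p i ≡ levels q i
    agree′ i i<m = cong +_ (trans (level-cong (p (suc i)) (first-agree i (ℕ.<⇒≤ i<m)))
                                  (cong (level (q i)) (agree i i<m)))
    last : level (p m) (p (suc m)) < level (q m) (q (suc m))
    last = subst₂ _<_ (cong (level (p m)) (sym p-last)) (cong (level (q m)) (sym q-last))
                  (level-false<level-true (first-agree m ℕ.≤-refl))

  levels-<lex-head : 1 ≤ e → ∀ p q → p 0 ≡ true → q 0 ≡ false →
    p 1 ≡ false ⊎ q 1 ≡ true → levels p <lex levels q
  levels-<lex-head e≥1 p q p0 q0 second = 0 , (λ _ ()) , +<+ first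
    where
    first : level (p 0) (p 1) < level (q 0) (q 1)
    first = subst₂ _<_ (cong (λ x → level x (p 1)) (sym p0)) (cong (λ x → level x (q 1)) (sym q0))
                   (level-true<level-false e≥1 second)

  -- Either the first letters already decide (p 0 = true, q 0 = false and e ≥ 1), or the
  -- first coordinates are irrelevant there and the first difference is at m.
  levels-<lex : ∀ p q m → q 0 ≡ false ⊎ p 0 ≡ true → p 1 ≡ false ⊎ q 1 ≡ true →
    (∀ i → i < m → p (suc i) ≡ q (suc i)) → p (suc m) ≡ false → q (suc m) ≡ true →
    levels p <lex levels q
  levels-<lex p q m head second agree p-last q-last with ≡0⊎≥1 e | p 0 in p0 | q 0 in q0
  ... | inj₁ e≡0 | _     | _     = levels-<lex-tail p q m (inj₂ e≡0) agree p-last q-last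
  ... | inj₂ _   | false | false = levels-<lex-tail p q m (inj₁ (trans p0 (sym q0)))
                                                     agree p-last q-last
  ... | inj₂ _   | true  | true  = levels-<lex-tail p q m (inj₁ (trans p0 (sym q0)))
                                                     agree p-last q-last
  ... | inj₂ e≥1 | true  | false = levels-<lex-head e≥1 p q p0 q0 second
  ... | inj₂ _   | false | true with head
  ...   | inj₁ ()
  ...   | inj₂ ()

  shift-M<lex-M : ∀ k → 1 ≤ k → shift k M <lex M
  shift-M<lex-M (suc k) _ with departure false (suc (suc k)) (λ ())
  ... | m , agree , last , last′ =
    <lex-resp-≗ (shift-M≗levels (suc k)) M≗levels
      (levels-<lex (λ n → τ (suc k + n)) τ m (inj₁ τ-zero) (inj₂ τ-one)
        (λ i i<m → trans (cong τ (ℕ.+-suc (suc k) i)) (agree i i<m))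
        (trans (cong τ (ℕ.+-suc (suc k) m)) last) last′)

  bar-M<lex-shift-M : ∀ k → bar b M <lex shift k M
  bar-M<lex-shift-M k with departure true (suc k) (λ _ → refl)
  ... | m , agree , last , last′ =
    <lex-resp-≗ bar-M≗levels (shift-M≗levels k)
      (levels-<lex (not ∘ τ) (λ n → τ (k + n)) m
        (inj₂ (cong not τ-zero)) (inj₁ (cong not τ-one))
        (λ i i<m → sym (trans (cong τ (ℕ.+-suc k i)) (agree i i<m)))
        (cong not last′) (trans (cong τ (ℕ.+-suc k m)) last))

  M-zero : M 0 ≡ + t
  M-zero = trans (M≗levels 0) (cong₂ (λ x y → + level x y) τ-zero τ-one)

  M∈Γstrict : Γstrict b t M
  M∈Γstrict = M-in-alphabet , M-zero , λ k k≥1 → bar-M<lex-shift-M k , shift-M<lex-M k k≥1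
    where
    M-in-alphabet : ∀ n → InAlphabet b t (M n)
    M-in-alphabet n = subst (InAlphabet b t) (sym (M≗levels n)) (level-in-alphabet (τ n) (τ (suc n)))

  Γstrict⊆NonperiodicΓ : ∀ B → Γstrict b t B → NonperiodicΓ b t B
  Γstrict⊆NonperiodicΓ B (in-alphabet , B0 , strict) = (in-alphabet , B0 , ordered) , aperiodic
    where
    bar-head<head : bar b B 0 <ℤ B 0
    bar-head<head = subst₂ _<ℤ_ (sym (trans (cong (λ x → + b - x) B0) b-t≡d)) (sym B0)
                           (+<+ (s≤s (ℕ.m≤m+n d e)))
    ordered : ShiftOrdered b B
    ordered zero    = <⇒≤lex (0 , (λ _ ()) , bar-head<head) , ≗⇒¬<lex (λ _ → refl)
    ordered (suc k) = <⇒≤lex (proj₁ (strict (suc k) (s≤s z≤n)))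
                    , <⇒≤lex (proj₂ (strict (suc k) (s≤s z≤n)))
    aperiodic : ¬ Periodic B
    aperiodic (k , k≥1 , period) = ≗⇒¬<lex period (proj₂ (strict k k≥1))

  M-antiperiodic : ∀ k i → suc i < 2 ^ k → M (2 ^ k + i) ≡ bar b M i
  M-antiperiodic k i si< = begin
    M (2 ^ k + i)                                   ≡⟨ M≗levels _ ⟩
    + level (τ (2 ^ k + i)) (τ (suc (2 ^ k + i)))   ≡⟨ cong₂ (λ x y → + level x y) τ-here τ-next ⟩
    + level (not (τ i)) (not (τ (suc i)))           ≡⟨ bar-M≗levels i ⟨
    bar b M i                                       ∎
    where
    τ-here : τ (2 ^ k + i) ≡ not (τ i)
    τ-here = τ-block k i (ℕ.<-trans (ℕ.n<1+n i) si<)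
    τ-next : τ (suc (2 ^ k + i)) ≡ not (τ (suc i))
    τ-next = trans (cong τ (sym (ℕ.+-suc (2 ^ k) i))) (τ-block k (suc i) si<)

  M-block-end : ∀ k j → suc j ≡ 2 ^ k →
    bar b M j ≡ + level (not (τ j)) false × M (2 ^ k + j) ≡ + suc (level (not (τ j)) false)
  M-block-end k j sj≡h = bar-M-j , M-h+j
    where
    bar-M-j : bar b M j ≡ + level (not (τ j)) false
    bar-M-j = trans (bar-M≗levels j)
                    (cong (λ y → + level (not (τ j)) (not y)) (trans (cong τ sj≡h) (τ-power k)))
    τ-h+j : τ (2 ^ k + j) ≡ not (τ j)
    τ-h+j = τ-block k j (ℕ.≤-reflexive sj≡h)
    τ-2h : τ (suc (2 ^ k + j)) ≡ true
    τ-2h = begin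
      τ (suc (2 ^ k + j))   ≡⟨ cong τ (ℕ.+-suc (2 ^ k) j) ⟨
      τ (2 ^ k + suc j)     ≡⟨ cong (λ m → τ (2 ^ k + m)) sj≡h ⟩
      τ (2 ^ k + 2 ^ k)     ≡⟨ cong τ (double (2 ^ k)) ⟩
      τ (2 ^ suc k)         ≡⟨ τ-power (suc k) ⟩
      true                  ∎
    M-h+j : M (2 ^ k + j) ≡ + suc (level (not (τ j)) false)
    M-h+j = begin
      M (2 ^ k + j)                                   ≡⟨ M≗levels _ ⟩
      + level (τ (2 ^ k + j)) (τ (suc (2 ^ k + j)))   ≡⟨ cong₂ (λ x y → + level x y) τ-h+j τ-2h ⟩
      + level (not (τ j)) true                        ≡⟨ cong +_ (level-suc (not (τ j))) ⟩
      + suc (level (not (τ j)) false)                 ∎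

  module FirstDifference {B : Seq} (ordered : ShiftOrdered b B) (k j : ℕ) (j<h : j < 2 ^ k)
    (agree : ∀ i → i < 2 ^ k + j → B i ≡ M i) (B<M : B (2 ^ k + j) <ℤ M (2 ^ k + j)) where

    h≥1 : 1 ≤ 2 ^ k
    h≥1 = ℕ.m^n>0 2 k

    bar-agree : ∀ i → i ≤ j → bar b B i ≡ bar b M i
    bar-agree i i≤j = cong (λ x → + b - x) (agree i (ℕ.≤-<-trans i≤j (ℕ.m<n+m j h≥1)))

    B-antiperiodic-below : ∀ i → i < j → B (2 ^ k + i) ≡ bar b B i
    B-antiperiodic-below i i<j = begin
      B (2 ^ k + i)   ≡⟨ agree _ (ℕ.+-monoʳ-< (2 ^ k) i<j) ⟩
      M (2 ^ k + i)   ≡⟨ M-antiperiodic k i (ℕ.≤-<-trans i<j j<h) ⟩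
      bar b M i       ≡⟨ bar-agree i (ℕ.<⇒≤ i<j) ⟨
      bar b B i       ∎

    B≮bar : ¬ (B (2 ^ k + j) <ℤ bar b B j)
    B≮bar lt = proj₁ (ordered (2 ^ k)) (j , B-antiperiodic-below , lt)

    j-is-last : suc j ≡ 2 ^ k
    j-is-last with ℕ.m≤n⇒m<n∨m≡n j<h
    ... | inj₂ sj≡h = sj≡h
    ... | inj₁ sj<h = ⊥-elim (B≮bar (subst (B (2 ^ k + j) <ℤ_) M≡bar-B B<M))
      where
      M≡bar-B : M (2 ^ k + j) ≡ bar b B j
      M≡bar-B = trans (M-antiperiodic k j sj<h) (sym (bar-agree j ℕ.≤-refl))

    B-antiperiodic-last : B (2 ^ k + j) ≡ bar b B j
    B-antiperiodic-last = trans (x<1+n∧x≮n⇒x≡n _ B<n+1 B≮n) (sym bar-B-j)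
      where
      bar-B-j : bar b B j ≡ + level (not (τ j)) false
      bar-B-j = trans (bar-agree j ℕ.≤-refl) (proj₁ (M-block-end k j j-is-last))
      B<n+1 : B (2 ^ k + j) <ℤ + suc (level (not (τ j)) false)
      B<n+1 = subst (B (2 ^ k + j) <ℤ_) (proj₂ (M-block-end k j j-is-last)) B<M
      B≮n : ¬ (B (2 ^ k + j) <ℤ + level (not (τ j)) false)
      B≮n lt = B≮bar (subst (B (2 ^ k + j) <ℤ_) (sym bar-B-j) lt)

    B-antiperiodic : ∀ i → i < 2 ^ k → B (2 ^ k + i) ≡ bar b B i
    B-antiperiodic i i<h with ℕ.m≤n⇒m<n∨m≡n i≤j
      where
      i≤j : i ≤ j
      i≤j = ℕ.≤-pred (ℕ.<-≤-trans i<h (ℕ.≤-reflexive (sym j-is-last)))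
    ... | inj₁ i<j  = B-antiperiodic-below i i<j
    ... | inj₂ refl = B-antiperiodic-last

    B-periodic : Periodic B
    B-periodic = antiperiodic-prefix⇒periodic ordered h≥1 B-antiperiodic

  M-minimal : ∀ B → NonperiodicΓ b t B → M ≤lex B
  M-minimal B ((_ , B0 , _) , _) (zero , _ , B0<M0) = ℤ.<-irrefl (trans B0 (sym M-zero)) B0<M0
  M-minimal B ((_ , _ , ordered) , aperiodic) (suc n , agree , B<M)
    with leading-power (suc n) (s≤s z≤n)
  ... | k , j , n≡ , j<h = aperiodic (FirstDifference.B-periodic ordered k j j<h agree′ B<M′)
    where
    agree′ : ∀ i → i < 2 ^ k + j → B i ≡ M i
    agree′ i i< = agree i (subst (i <_) (sym n≡) i<)
    B<M′ : B (2 ^ k + j) <ℤ M (2 ^ k + j)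
    B<M′ = subst (λ m → B m <ℤ M m) n≡ B<M

  M-least-nonperiodic : IsLeast (NonperiodicΓ b t) M
  M-least-nonperiodic = Γstrict⊆NonperiodicΓ M M∈Γstrict , M-minimal

  M-least-strict : IsLeast (Γstrict b t) M
  M-least-strict = M∈Γstrict , λ B B∈Γstrict →
    M-minimal B (Γstrict⊆NonperiodicΓ B B∈Γstrict)

  2t≡b+1+e : 2 * t ≡ b + suc e
  2t≡b+1+e = solved d e
    where
    solved : ∀ d e → 2 * suc (d + e) ≡ suc (d + e) + d + suc e
    solved = ℕ-Solver.solve-∀

  e-determined : ∀ {k} → 2 * t ≡ b + suc k → e ≡ k
  e-determined eq = ℕ.suc-injective (ℕ.+-cancelˡ-≡ b _ _ (trans (sym 2t≡b+1+e) eq))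

  letter-< : ∀ {x y x′ y′} → level x y < level x′ y′ →
    letter (+ b) (+ t) x y <ℤ letter (+ b) (+ t) x′ y′
  letter-< {x} {y} {x′} {y′} lt =
    subst₂ _<ℤ_ (sym (letter≡level x y)) (sym (letter≡level x′ y′)) (+<+ lt)

  M-renamed-fixed-point : IsRenamedFixedPoint b t M
  M-renamed-fixed-point = M-zero , λ n →
    RenamedRule-resp (M≗letter n)
      (trans (M≗letter (2 * n)) (cong₂ (letter (+ b) (+ t)) (τ-even n) (τ-odd n)))
      (trans (M≗letter (suc (2 * n))) (cong₂ (letter (+ b) (+ t)) (τ-odd n) (τ-even-suc n)))
      (letter-rule b t (τ n) (τ (suc n)))

  renamed-morphism-case : b + 3 ≤ 2 * t →
      (+ b - + t <ℤ + b - + t +ℤ + 1)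
    × (+ b - + t +ℤ + 1 <ℤ + t - + 1)
    × (+ t - + 1 <ℤ + t)
    × IsRenamedFixedPoint b t M
  renamed-morphism-case b+3≤2t =
      letter-< {true} {false} {true} {true} (ℕ.n<1+n d)
    , letter-< {true} {true} {false} {false} (subst (_< d + e) (ℕ.+-comm d 1) (ℕ.+-monoʳ-< d e≥2))
    , letter-< {false} {false} {false} {true} (ℕ.n<1+n (d + e))
    , M-renamed-fixed-point
    where
    e≥2 : 2 ≤ e
    e≥2 = ℕ.≤-pred (ℕ.+-cancelˡ-≤ b 3 (suc e) (subst (b + 3 ≤_) 2t≡b+1+e b+3≤2t))

  gmap-code : e ≡ 1 → ∀ x y → gmap b t (code x y) ≡ letter (+ b) (+ t) x y
  gmap-code _   false false = refl
  gmap-code _   false true  = refl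
  gmap-code _   true  false = refl
  gmap-code e≡1 true  true  =
    trans (cong +_ (trans (cong (λ m → d + m) e≡1) (ℕ.+-comm d 1)))
          (sym (letter≡level true true))

  hmap-code : e ≡ 0 → ∀ x y → hmap b t (code x y) ≡ letter (+ b) (+ t) x y
  hmap-code _   false false = refl
  hmap-code _   false true  = refl
  hmap-code e≡0 true  y     =
    trans (hmap-code-true y)
          (trans (cong +_ (level-first-irrelevant e≡0 false y)) (sym (letter≡level true y)))
    where
    hmap-code-true : ∀ y → hmap b t (code true y) ≡ + level false y
    hmap-code-true false = refl
    hmap-code-true true  = refl

  M-image-of-Θ∞-under-g : 2 * t ≡ b + 2 → ∀ n → M n ≡ gmap b t (Θ∞ n)
  M-image-of-Θ∞-under-g 2t≡b+2 n = begin
    M n                                      ≡⟨ M≗letter n ⟩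
    letter (+ b) (+ t) (τ n) (τ (suc n))     ≡⟨ gmap-code (e-determined 2t≡b+2) (τ n) (τ (suc n)) ⟨
    gmap b t (code (τ n) (τ (suc n)))        ≡⟨ cong (gmap b t) (Θ∞-code n) ⟨
    gmap b t (Θ∞ n)                          ∎

  M-image-of-Θ∞-under-h : 2 * t ≡ b + 1 → ∀ n → M n ≡ hmap b t (Θ∞ n)
  M-image-of-Θ∞-under-h 2t≡b+1 n = begin
    M n                                      ≡⟨ M≗letter n ⟩
    letter (+ b) (+ t) (τ n) (τ (suc n))     ≡⟨ hmap-code (e-determined 2t≡b+1) (τ n) (τ (suc n)) ⟨
    hmap b t (code (τ n) (τ (suc n)))        ≡⟨ cong (hmap b t) (Θ∞-code n) ⟨
    hmap b t (Θ∞ n)                          ∎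

parametrise : ∀ {b t} → t ≤ b → b < 2 * t → ∃₂ λ d e → t ≡ suc (d + e) × b ≡ t + d
parametrise {b} {t} t≤b b<2t =
  b ∸ t , t ∸ suc (b ∸ t) , sym (ℕ.m+[n∸m]≡n d<t) , sym (ℕ.m+[n∸m]≡n t≤b)
  where
  d<t : b ∸ t < t
  d<t = ℕ.+-cancelˡ-< t (b ∸ t) t
          (subst₂ _<_ (sym (ℕ.m+[n∸m]≡n t≤b)) (sym (double t)) b<2t)

-- The hypothesis 1 ≤ b follows from t ≤ b < 2 t.
theorem2p11 : (b t : ℕ) → 1 ≤ b → t ≤ b → b < 2 * t →
    (ε : ℕ → ℕ) → IsThueMorse ε →
    IsLeast (NonperiodicΓ b t) (Mseq b t ε)
    × (∀ A → IsLeast (NonperiodicΓ b t) A → ∀ n → A n ≡ Mseq b t ε n)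
    × IsLeast (Γstrict b t) (Mseq b t ε)
    × (b + 3 ≤ 2 * t →
        ((+ b) - (+ t) <ℤ (+ b) - (+ t) +ℤ (+ 1))
        × ((+ b) - (+ t) +ℤ (+ 1) <ℤ (+ t) - (+ 1))
        × ((+ t) - (+ 1) <ℤ + t)
        × IsRenamedFixedPoint b t (Mseq b t ε))
    × (2 * t ≡ b + 2 → ∀ n → Mseq b t ε n ≡ gmap b t (Θ∞ n))
    × (2 * t ≡ b + 1 → ∀ n → Mseq b t ε n ≡ hmap b t (Θ∞ n))
theorem2p11 b t _ t≤b b<2t ε isTM with parametrise t≤b b<2t
... | d , e , refl , refl =
    M-least-nonperiodic
  , (λ A A-least → IsLeast-unique A-least M-least-nonperiodic)
  , M-least-strict
  , renamed-morphism-case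
  , M-image-of-Θ∞-under-g
  , M-image-of-Θ∞-under-h
  where open Smallest d e ε isTM
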